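{- Let $D$ be a non-trivial strongly connected digraph. (a) The following are equivalent: (i) $D$ is a bioriented complete graph; (ii) $\mathrm{diam}(D)=1$; (iii) $\overrightarrow{rc}(D)=1$; (iv) $\overrightarrow{src}(D)=1$; (v) $\overrightarrow{rvc}(D)=0$; (vi) $\overrightarrow{srvc}(D)=0$; (vii) $\overrightarrow{trc}(D)=1$; (viii) $\overrightarrow{strc}(D)=1$. (b) $\overrightarrow{strc}(D)\ge \overrightarrow{trc}(D)\ge 3$ if and only if $D$ is not a bioriented complete graph. (c) (i) $\overrightarrow{rc}(D)=2$ iff $\overrightarrow{src}(D)=2$. (ii) $\overrightarrow{rvc}(D)=1$ iff $\overrightarrow{srvc}(D)=1$ iff $\mathrm{diam}(D)=2$. (iii) $\overrightarrow{rvc}(D)=2$ iff $\overrightarrow{srvc}(D)=2$. (iv) $\overrightarrow{trc}(D)=3$ iff $\overrightarrow{strc}(D)=3$. (v) $\overrightarrow{trc}(D)=4$ iff $\overrightarrow{strc}(D)=4$. Moreover, any of the conditions in (c)(i) implies any of the conditions in (c)(iv), and any of the conditions in (c)(i), (c)(iv) and (c)(v) implies any of the conditions in (c)(ii).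
   Context: All digraphs are finite, without loops and without multiple arcs. A digraph is strongly connected if for every ordered pair $(u,v)$ there is a directed $u$–$v$ path; path length is the number of arcs, $d(u,v)$ is the length of a shortest $u$–$v$ path, a $u$–$v$ geodesic is a $u$–$v$ path of length $d(u,v)$, and $\mathrm{diam}(D)=\max d(u,v)$. The biorientation of a graph $G$ replaces each edge $uv$ by the two arcs $uv$ and $vu$; a bioriented complete graph is the biorientation of a complete graph. An arc-coloured path is rainbow if its arcs have distinct colours; a vertex-coloured path is vertex-rainbow if its internal vertices have distinct colours; a total-coloured path (colours on vertices and arcs) is total-rainbow if its arcs and internal vertices all receive pairwise distinct colours. $\overrightarrow{rc}(D)$ (resp. $\overrightarrow{src}(D)$) is the minimum number of colours in an arc-colouring such that every ordered pair $(u,v)$ is joined by a rainbow $u$–$v$ path (resp. rainbow $u$–$v$ geodesic). $\overrightarrow{rvc}(D)$ (resp. $\overrightarrow{srvc}(D)$) is the minimum number of colours in a vertex-colouring such that every ordered pair is joined by a vertex-rainbow path (resp. vertex-rainbow geodesic); in particular this number is $0$ if no internal vertices ever need colouring. $\overrightarrow{trc}(D)$ (resp. $\overrightarrow{strc}(D)$) is the minimum number of colours in a total-colouring such that every ordered pair is joined by a total-rainbow path (resp. total-rainbow geodesic). -}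

module Defs where

open import Data.Nat using (ℕ; zero; suc; _≤_; _<_)
open import Data.Fin using (Fin; zero; suc; toℕ; fromℕ; inject₁)
open import Data.Maybe using (Maybe; just)
open import Data.Bool using (Bool; true; false)
open import Data.Product using (Σ; ∃; _×_; _,_)
open import Relation.Binary.PropositionalEquality using (_≡_; _≢_)
open import Relation.Nullary using (¬_)
open import Function.Definitions using (Injective)

record Digraph : Set where
  field
    n        : ℕ
    arc      : Fin n → Fin n → Bool
    loopless : ∀ v → arc v v ≡ false

open Digraph public

NonTrivial : Digraph → Set
NonTrivial D = 2 ≤ n D

record Path (D : Digraph) (u v : Fin (n D)) : Set where
  field
    len      : ℕ
    vtx      : Fin (suc len) → Fin (n D)
    start    : vtx zero ≡ u
    end      : vtx (fromℕ len) ≡ v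
    step     : ∀ (i : Fin len) → arc D (vtx (inject₁ i)) (vtx (suc i)) ≡ true
    distinct : Injective _≡_ _≡_ vtx

open Path public

StronglyConnected : Digraph → Set
StronglyConnected D = ∀ (u v : Fin (n D)) → Path D u v

IsGeodesic : ∀ {D u v} → Path D u v → Set
IsGeodesic {D} {u} {v} P = ∀ (Q : Path D u v) → len P ≤ len Q

Diam : Digraph → ℕ → Set
Diam D k =
  (∀ (u v : Fin (n D)) → u ≢ v → Σ (Path D u v) (λ P → len P ≤ k)) ×
  Σ (Fin (n D)) (λ u → Σ (Fin (n D)) (λ v → u ≢ v ×
     Σ (Path D u v) (λ P → IsGeodesic P × len P ≡ k)))

BiorientedComplete : Digraph → Set
BiorientedComplete D = ∀ (u v : Fin (n D)) → u ≢ v → arc D u v ≡ true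

Internal : ∀ {D u v} (P : Path D u v) → Fin (suc (len P)) → Set
Internal P i = 0 < toℕ i × toℕ i < len P

arcCol : ∀ {D u v} {C : Set} → (Fin (n D) → Fin (n D) → C) → (P : Path D u v) → Fin (len P) → C
arcCol c P i = c (vtx P (inject₁ i)) (vtx P (suc i))

Rainbow : ∀ {D u v k} → (Fin (n D) → Fin (n D) → Fin k) → Path D u v → Set
Rainbow c P = ∀ i j → arcCol c P i ≡ arcCol c P j → i ≡ j

-- Vertex-colourings with k colours are maps to Maybe (Fin k) (nothing = uncoloured),
-- so that k = 0 is meaningful; internal vertices must be coloured and distinct.
VertexRainbow : ∀ {D u v k} → (Fin (n D) → Maybe (Fin k)) → Path D u v → Set
VertexRainbow c P =
  (∀ i → Internal P i → ∃ (λ a → c (vtx P i) ≡ just a)) ×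
  (∀ i j → Internal P i → Internal P j → c (vtx P i) ≡ c (vtx P j) → i ≡ j)

TotalRainbow : ∀ {D u v k} → (Fin (n D) → Fin k) → (Fin (n D) → Fin (n D) → Fin k) →
               Path D u v → Set
TotalRainbow cv ca P =
  Rainbow ca P ×
  (∀ i j → Internal P i → Internal P j → cv (vtx P i) ≡ cv (vtx P j) → i ≡ j) ×
  (∀ i j → Internal P j → arcCol ca P i ≢ cv (vtx P j))

RainbowConnecting : Digraph → ℕ → Set
RainbowConnecting D k = Σ (Fin (n D) → Fin (n D) → Fin k) λ c →
  ∀ (u v : Fin (n D)) → u ≢ v → Σ (Path D u v) (Rainbow c)

StrongRainbowConnecting : Digraph → ℕ → Set
StrongRainbowConnecting D k = Σ (Fin (n D) → Fin (n D) → Fin k) λ c →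
  ∀ (u v : Fin (n D)) → u ≢ v → Σ (Path D u v) (λ P → IsGeodesic P × Rainbow c P)

RainbowVertexConnecting : Digraph → ℕ → Set
RainbowVertexConnecting D k = Σ (Fin (n D) → Maybe (Fin k)) λ c →
  ∀ (u v : Fin (n D)) → u ≢ v → Σ (Path D u v) (VertexRainbow c)

StrongRainbowVertexConnecting : Digraph → ℕ → Set
StrongRainbowVertexConnecting D k = Σ (Fin (n D) → Maybe (Fin k)) λ c →
  ∀ (u v : Fin (n D)) → u ≢ v → Σ (Path D u v) (λ P → IsGeodesic P × VertexRainbow c P)

TotalRainbowConnecting : Digraph → ℕ → Set
TotalRainbowConnecting D k =
  Σ (Fin (n D) → Fin k) λ cv → Σ (Fin (n D) → Fin (n D) → Fin k) λ ca →
  ∀ (u v : Fin (n D)) → u ≢ v → Σ (Path D u v) (TotalRainbow cv ca)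

StrongTotalRainbowConnecting : Digraph → ℕ → Set
StrongTotalRainbowConnecting D k =
  Σ (Fin (n D) → Fin k) λ cv → Σ (Fin (n D) → Fin (n D) → Fin k) λ ca →
  ∀ (u v : Fin (n D)) → u ≢ v → Σ (Path D u v) (λ P → IsGeodesic P × TotalRainbow cv ca P)

IsMinimum : (ℕ → Set) → ℕ → Set
IsMinimum P m = P m × (∀ k → k < m → ¬ P k)

Rc Src Rvc Srvc Trc Strc : Digraph → ℕ → Set
Rc   D = IsMinimum (RainbowConnecting D)
Src  D = IsMinimum (StrongRainbowConnecting D)
Rvc  D = IsMinimum (RainbowVertexConnecting D)
Srvc D = IsMinimum (StrongRainbowVertexConnecting D)
Trc  D = IsMinimum (TotalRainbowConnecting D)
Strc D = IsMinimum (StrongTotalRainbowConnecting D)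

module Submission where

-- A rainbow path with k colours has at most k arcs, a
--   vertex-rainbow path has at most k internal vertices, and a total-rainbow
--   path of length l uses l + (l - 1) distinct colours.  So a connecting
--   colouring with few colours forces all distances to be small, and
--   "every pair at distance ≤ 1" is exactly bioriented completeness.
-- * Strengthening.  If a path P is not a geodesic, some geodesic is shorter.
--   When the colour count is small, that shorter geodesic is so short
--   (length ≤ 1, or ≤ 2 with every vertex coloured) that it is rainbow for
--   trivial reasons; hence for k ≤ 2 (arc, vertex) and k ≤ 4 (total) a
--   k-colouring connecting by rainbow paths connects by rainbow geodesics.
-- * Existence of the minima.  Paths have fewer than n vertices and colourings
--   are maps between finite sets, so connectivity by (geodesic) total-rainbow
--   paths with k colours is decidable; giving all vertices and arcs distinct
--   colours works, hence trc(D) and strc(D) exist (needed for part (b)).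

open import Defs
open import Data.Nat using (ℕ; zero; suc; pred; _+_; _*_; _≤_; _<_; _<?_; z≤n; s≤s)
  renaming (_≟_ to _≟ℕ_)
open import Data.Nat.Properties using (anyUpTo?; ≤-refl; ≤-trans; ≤-antisym; ≤-pred; <⇒≤; <⇒≱;
  ≮⇒≥; ≰⇒>; <-irrefl; +-mono-≤; n<1⇒n≡0)
open import Data.Nat.Induction using (<-wellFounded)
open import Induction.WellFounded using (Acc; acc)
open import Data.Fin using (Fin; zero; suc; toℕ; fromℕ; fromℕ<; inject₁; _↑ˡ_; _↑ʳ_; splitAt; join;
  combine; remQuot; finToFun; funToFin)
open import Data.Fin.Properties using (any?; all?; _≟_; injective⇒≤; toℕ-injective; toℕ<n;
  inject₁ℕ<; inject₁-injective; fromℕ≢inject₁; join-splitAt; splitAt-↑ˡ; splitAt-↑ʳ;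
  toℕ-fromℕ<; remQuot-combine; combine-injectiveˡ; ↑ˡ-injective; ↑ʳ-injective;
  finToFun-funToFin; suc-injective)
open import Data.Maybe using (Maybe; just; nothing; fromMaybe)
open import Data.Bool using (true)
import Data.Bool.Properties as Bool
open import Data.Product using (Σ; ∃; _×_; _,_; proj₁; proj₂; map₂; uncurry)
open import Data.Sum using (_⊎_; inj₁; inj₂; [_,_]′)
open import Data.Empty using (⊥; ⊥-elim)
open import Relation.Nullary using (¬_; Dec; yes; no)
open import Relation.Nullary.Decidable using (_×-dec_; _→-dec_; ¬?; map′; decidable-stable)
open import Relation.Unary using (Decidable)
open import Relation.Binary.PropositionalEquality
open import Function using (_∘_)
open import Function.Bundles using (_⇔_; mk⇔; Equivalence)
open import Function.Definitions using (Injective)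

minimum : {P : ℕ → Set} → Decidable P → ∀ {m} → P m → Σ ℕ (IsMinimum P)
minimum {P} P? {m} pm = descend m (<-wellFounded m) pm
  where
  descend : ∀ m → Acc _<_ m → P m → Σ ℕ (IsMinimum P)
  descend m (acc smaller) pm with anyUpTo? P? m
  ... | yes (k , k<m , pk) = descend k (smaller k<m) pk
  ... | no none            = m , pm , λ k k<m pk → none (k , k<m , pk)

below-minimum : ∀ {P : ℕ → Set} {m k} → IsMinimum P m → P k → k < m → ⊥
below-minimum (_ , none) pk k<m = none _ k<m pk

minimum-agree : ∀ {X Y : ℕ → Set} K {m} → (∀ {k} → k ≤ K → X k → Y k) →
                (∀ {k} → k ≤ K → Y k → X k) → m ≤ K → IsMinimum X m ⇔ IsMinimum Y m
minimum-agree K x⇒y y⇒x m≤K = mk⇔ (transfer x⇒y y⇒x) (transfer y⇒x x⇒y)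
  where
  transfer : ∀ {X Y : ℕ → Set} → (∀ {k} → k ≤ K → X k → Y k) →
             (∀ {k} → k ≤ K → Y k → X k) → IsMinimum X _ → IsMinimum Y _
  transfer f g (xm , none) = f m≤K xm , λ k k<m yk → none k k<m (g (≤-trans (<⇒≤ k<m) m≤K) yk)

-- Existence over the finite set of functions Fin m → Fin k is decidable for
-- properties invariant under pointwise equality (functions are coded by Fin (k ^ m)).
any-function? : ∀ {m k} {P : (Fin m → Fin k) → Set} →
                (∀ {f g} → (∀ x → f x ≡ g x) → P f → P g) → Decidable P → Dec (∃ P)
any-function? resp P? = map′ (λ { (i , p) → finToFun i , p })
  (λ { (f , p) → funToFin f , resp (λ x → sym (finToFun-funToFin f x)) p })
  (any? (P? ∘ finToFun))

disjoint-injections⇒≤ : ∀ {a b k} (f : Fin a → Fin k) (g : Fin b → Fin k) →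
  Injective _≡_ _≡_ f → Injective _≡_ _≡_ g → (∀ i j → f i ≢ g j) → a + b ≤ k
disjoint-injections⇒≤ {a} {b} f g f-inj g-inj disjoint =
  injective⇒≤ {f = [ f , g ]′ ∘ splitAt a} λ {x} {y} e →
    trans (sym (join-splitAt a b x))
          (trans (cong (join a b) (both (splitAt a x) (splitAt a y) e)) (join-splitAt a b y))
  where
  both : ∀ s t → [ f , g ]′ s ≡ [ f , g ]′ t → s ≡ t
  both (inj₁ x) (inj₁ y) e = cong inj₁ (f-inj e)
  both (inj₁ x) (inj₂ y) e = ⊥-elim (disjoint x y e)
  both (inj₂ x) (inj₁ y) e = ⊥-elim (disjoint y x (sym e))
  both (inj₂ x) (inj₂ y) e = cong inj₂ (g-inj e)

pred-bound : ∀ {l k} → pred l ≤ k → l ≤ suc k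
pred-bound {zero}  _ = z≤n
pred-bound {suc l} h = s≤s h

half-bound : ∀ {l m} → l + pred l ≤ m + m → l ≤ m
half-bound {l} {m} h = ≮⇒≥ λ m<l → <-irrefl refl (≤-trans (too-many l m<l) h)
  where
  too-many : ∀ l → m < l → suc (m + m) ≤ l + pred l
  too-many (suc l) (s≤s m≤l) = +-mono-≤ (s≤s m≤l) m≤l

Inner : (l : ℕ) → Fin (suc l) → Set
Inner l i = 0 < toℕ i × toℕ i < l

inner : ∀ {l} → Fin (pred l) → Fin (suc l)
inner {suc l} i = suc (inject₁ i)

inner-is-inner : ∀ {l} (i : Fin (pred l)) → Inner l (inner i)
inner-is-inner {suc l} i = s≤s z≤n , s≤s (inject₁ℕ< i)

inner-injective : ∀ {l} → Injective _≡_ _≡_ (inner {l})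
inner-injective {suc l} e = inject₁-injective (suc-injective e)

no-inner : ∀ {l} → l ≤ 1 → (i : Fin (suc l)) → ¬ Inner l i
no-inner l≤1 i (0<i , i<l) = <-irrefl refl (≤-trans (≤-trans (s≤s 0<i) i<l) l≤1)

unique-inner : ∀ {l} → l ≤ 2 → ∀ i j → Inner l i → Inner l j → i ≡ j
unique-inner l≤2 i j ii ij = toℕ-injective (trans (is-one i ii) (sym (is-one j ij)))
  where
  is-one : ∀ x → Inner _ x → toℕ x ≡ 1
  is-one x (0<x , x<l) = ≤-antisym (≤-pred (≤-trans x<l l≤2)) 0<x

fin≤1-unique : ∀ {l} → l ≤ 1 → (i j : Fin l) → i ≡ j
fin≤1-unique l≤1 i j = toℕ-injective (trans (zero-index i) (sym (zero-index j)))
  where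
  zero-index : ∀ x → toℕ x ≡ 0
  zero-index x = n<1⇒n≡0 (≤-trans (toℕ<n x) l≤1)

-- Total-rainbow condition on a coloured sequence: σ colours the l + 1
-- vertices, α the l arcs.  TotalRainbow cv ca P unfolds to this with
-- σ = cv ∘ vtx P and α = arcCol ca P.
TotalRainbowSeq : ∀ {k} l → (Fin (suc l) → Fin k) → (Fin l → Fin k) → Set
TotalRainbowSeq l σ α =
  (∀ i j → α i ≡ α j → i ≡ j) ×
  (∀ i j → Inner l i → Inner l j → σ i ≡ σ j → i ≡ j) ×
  (∀ i j → Inner l j → α i ≢ σ j)

totalRainbowSeq? : ∀ {k} l σ α → Dec (TotalRainbowSeq {k} l σ α)
totalRainbowSeq? l σ α =
  all? (λ i → all? λ j → (α i ≟ α j) →-dec (i ≟ j)) ×-dec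
  (all? (λ i → all? λ j → inner? i →-dec (inner? j →-dec ((σ i ≟ σ j) →-dec (i ≟ j)))) ×-dec
   all? (λ i → all? λ j → inner? j →-dec ¬? (α i ≟ σ j)))
  where
  inner? : ∀ i → Dec (Inner l i)
  inner? i = (0 <? toℕ i) ×-dec (toℕ i <? l)

totalRainbowSeq-resp : ∀ {k l σ σ′ α α′} → (∀ i → σ i ≡ σ′ i) → (∀ i → α i ≡ α′ i) →
                       TotalRainbowSeq {k} l σ α → TotalRainbowSeq l σ′ α′
totalRainbowSeq-resp eσ eα (arcs , vertices , apart) =
  (λ i j e → arcs i j (trans (eα i) (trans e (sym (eα j))))) ,
  (λ i j ii ij e → vertices i j ii ij (trans (eσ i) (trans e (sym (eσ j))))) ,
  (λ i j ij e → apart i j ij (trans (eα i) (trans e (sym (eσ j)))))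

totalRainbowSeq-colours : ∀ {k l σ α} → TotalRainbowSeq {k} l σ α → l + pred l ≤ k
totalRainbowSeq-colours {σ = σ} {α} (arcs , vertices , apart) =
  disjoint-injections⇒≤ α (σ ∘ inner)
    (λ {i} {j} → arcs i j)
    (λ {i} {j} e → inner-injective (vertices _ _ (inner-is-inner i) (inner-is-inner j) e))
    (λ i j → apart i (inner j) (inner-is-inner j))

-- A vertex colouring together with an arc colouring of a set Fin m is coded by
-- a single function on Fin (m + m * m): vertex x ↦ x ↑ˡ _, arc (x, y) ↦ m ↑ʳ combine x y.
module ColouringCode {m k : ℕ} where

  vertexPart : (Fin (m + m * m) → Fin k) → Fin m → Fin k
  vertexPart h x = h (x ↑ˡ m * m)

  arcPart : (Fin (m + m * m) → Fin k) → Fin m → Fin m → Fin k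
  arcPart h x y = h (m ↑ʳ combine x y)

  encode : (Fin m → Fin k) → (Fin m → Fin m → Fin k) → Fin (m + m * m) → Fin k
  encode cv ca = [ cv , uncurry ca ∘ remQuot m ]′ ∘ splitAt m

  vertexPart-encode : ∀ cv ca x → vertexPart (encode cv ca) x ≡ cv x
  vertexPart-encode cv ca x = cong [ cv , uncurry ca ∘ remQuot m ]′ (splitAt-↑ˡ m x (m * m))

  arcPart-encode : ∀ cv ca x y → arcPart (encode cv ca) x y ≡ ca x y
  arcPart-encode cv ca x y = begin
    arcPart (encode cv ca) x y                   ≡⟨ cong [ cv , uncurry ca ∘ remQuot m ]′
                                                       (splitAt-↑ʳ m (m * m) (combine x y)) ⟩
    uncurry ca (remQuot m (combine x y))         ≡⟨ cong (uncurry ca) (remQuot-combine x y) ⟩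
    ca x y                                       ∎
    where open ≡-Reasoning

  any-colouring? : {B : (Fin m → Fin k) → (Fin m → Fin m → Fin k) → Set} →
    (∀ {cv cv′ ca ca′} → (∀ x → cv x ≡ cv′ x) → (∀ x y → ca x y ≡ ca′ x y) → B cv ca → B cv′ ca′) →
    (∀ cv ca → Dec (B cv ca)) → Dec (Σ (Fin m → Fin k) λ cv → Σ (Fin m → Fin m → Fin k) (B cv))
  any-colouring? resp B? = map′
    (λ { (h , b) → vertexPart h , arcPart h , b })
    (λ { (cv , ca , b) → encode cv ca ,
         resp (λ x → sym (vertexPart-encode cv ca x)) (λ x y → sym (arcPart-encode cv ca x y)) b })
    (any-function? (λ e → resp (λ x → e _) (λ x y → e _)) (λ h → B? (vertexPart h) (arcPart h)))

module Paths (D : Digraph) where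

  N : ℕ
  N = n D

  path-nonempty : ∀ {u v} (P : Path D u v) → u ≢ v → 1 ≤ len P
  path-nonempty record { len = zero ; start = s ; end = e } u≢v = ⊥-elim (u≢v (trans (sym s) e))
  path-nonempty record { len = suc _ } _ = s≤s z≤n

  short⇒arc : ∀ {u v} (P : Path D u v) → len P ≤ 1 → u ≢ v → arc D u v ≡ true
  short⇒arc record { len = zero ; start = s ; end = e } _ u≢v = ⊥-elim (u≢v (trans (sym s) e))
  short⇒arc record { len = suc zero ; start = s ; end = e ; step = st } _ _ =
    subst₂ (λ x y → arc D x y ≡ true) s e (st zero)
  short⇒arc record { len = suc (suc _) } (s≤s ()) _

  arc-path : ∀ {u v} → arc D u v ≡ true → u ≢ v → Path D u v
  arc-path {u} {v} uv u≢v = record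
    { len = 1 ; vtx = ends ; start = refl ; end = refl ; step = λ { zero → uv }
    ; distinct = λ { {zero} {zero} _ → refl ; {zero} {suc zero} e → ⊥-elim (u≢v e)
                   ; {suc zero} {zero} e → ⊥-elim (u≢v (sym e)) ; {suc zero} {suc zero} _ → refl } }
    where
    ends : Fin 2 → Fin N
    ends zero    = u
    ends (suc _) = v

  short⇒geodesic : ∀ {u v} (P : Path D u v) → u ≢ v → len P ≤ 1 → IsGeodesic P
  short⇒geodesic P u≢v short Q = ≤-trans short (path-nonempty Q u≢v)

  -- Paths are finitely many: a path is a vertex sequence of length < N with
  -- decidable side conditions, so existence of a path whose vertex sequence has
  -- a decidable, pointwise-invariant property Q is decidable.
  module _ (u v : Fin N) where

    IsRoute : (l : ℕ) → (Fin (suc l) → Fin N) → Set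
    IsRoute l f = (f zero ≡ u) × (f (fromℕ l) ≡ v) ×
                  (∀ i → arc D (f (inject₁ i)) (f (suc i)) ≡ true) × (∀ x y → f x ≡ f y → x ≡ y)

    route? : ∀ l f → Dec (IsRoute l f)
    route? l f = (f zero ≟ u) ×-dec ((f (fromℕ l) ≟ v) ×-dec
      (all? (λ i → arc D (f (inject₁ i)) (f (suc i)) Bool.≟ true) ×-dec
       all? (λ x → all? λ y → (f x ≟ f y) →-dec (x ≟ y))))

    route-resp : ∀ {l f g} → (∀ i → f i ≡ g i) → IsRoute l f → IsRoute l g
    route-resp {l} e (s , t , steps , inj) =
      trans (sym (e zero)) s , trans (sym (e (fromℕ l))) t ,
      (λ i → subst₂ (λ x y → arc D x y ≡ true) (e (inject₁ i)) (e (suc i)) (steps i)) ,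
      λ x y q → inj x y (trans (e x) (trans q (sym (e y))))

    any-path? : (Q : (l : ℕ) → (Fin (suc l) → Fin N) → Set) → (∀ l → Decidable (Q l)) →
                (∀ l {f g} → (∀ i → f i ≡ g i) → Q l f → Q l g) →
                Dec (Σ (Path D u v) λ P → Q (len P) (vtx P))
    any-path? Q Q? Q-resp = map′ found complete (anyUpTo? route-with-Q? N)
      where
      RouteWithQ : ℕ → Set
      RouteWithQ l = ∃ λ f → IsRoute l f × Q l f

      route-with-Q? : Decidable RouteWithQ
      route-with-Q? l = any-function? (λ e → λ { (r , q) → route-resp e r , Q-resp l e q })
                                      (λ f → route? l f ×-dec Q? l f)

      found : ∃ (λ l → l < N × RouteWithQ l) → Σ (Path D u v) λ P → Q (len P) (vtx P)
      found (l , _ , f , (s , t , steps , inj) , q) =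
        record { len = l ; vtx = f ; start = s ; end = t ; step = steps
               ; distinct = λ {x} {y} → inj x y } , q

      complete : Σ (Path D u v) (λ P → Q (len P) (vtx P)) → ∃ (λ l → l < N × RouteWithQ l)
      complete (P , q) = len P , injective⇒≤ (distinct P) , vtx P ,
                         (start P , end P , step P , λ x y → distinct P) , q

  path-of-length? : ∀ u v → Decidable (λ l → Σ (Path D u v) λ Q → len Q ≡ l)
  path-of-length? u v l = any-path? u v (λ l′ _ → l′ ≡ l) (λ l′ _ → l′ ≟ℕ l) (λ _ _ e → e)

  geodesic : ∀ {u v} → Path D u v → Σ (Path D u v) IsGeodesic
  geodesic {u} {v} P with minimum (path-of-length? u v) (P , refl)
  ... | _ , (G , refl) , none-shorter = G , λ Q → ≮⇒≥ λ Q<G → none-shorter (len Q) Q<G (Q , refl)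

  shortest? : ∀ u v l → Dec (∀ (Q : Path D u v) → l ≤ len Q)
  shortest? u v l = map′ (λ none Q → ≮⇒≥ λ Q<l → none (Q , Q<l))
                         (λ all (Q , Q<l) → <⇒≱ Q<l (all Q))
                         (¬? (any-path? u v (λ l′ _ → l′ < l) (λ l′ _ → l′ <? l) (λ _ _ q → q)))

  geodesic-or-shorter : ∀ {u v} (P : Path D u v) →
                        IsGeodesic P ⊎ Σ (Path D u v) (λ G → IsGeodesic G × len G < len P)
  geodesic-or-shorter P with geodesic P
  ... | G , G-geo with len G <? len P
  ...   | yes G<P = inj₂ (G , G-geo , G<P)
  ...   | no  G≮P = inj₁ λ Q → ≤-trans (≮⇒≥ G≮P) (G-geo Q)

  strengthen : (X : ∀ {u v} → Path D u v → Set) (s : ℕ) →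
    (∀ {u v} (P : Path D u v) → X P → len P ≤ suc s) →
    (∀ {u v} (P : Path D u v) → len P ≤ s → X P) →
    (∀ u v → u ≢ v → Σ (Path D u v) X) →
    (∀ u v → u ≢ v → Σ (Path D u v) λ P → IsGeodesic P × X P)
  strengthen X s bound short connected u v u≢v with connected u v u≢v
  ... | P , xP with geodesic-or-shorter P
  ...   | inj₁ P-geo            = P , P-geo , xP
  ...   | inj₂ (G , G-geo , G<P) = G , G-geo , short G (≤-pred (≤-trans G<P (bound P xP)))

  rainbow-length : ∀ {u v k} {c : Fin N → Fin N → Fin k} (P : Path D u v) →
                   Rainbow c P → len P ≤ k
  rainbow-length P rainbow = injective⇒≤ λ {i} {j} → rainbow i j

  vertexRainbow-length : ∀ {u v k} {c : Fin N → Maybe (Fin k)} (P : Path D u v) →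
                         VertexRainbow c P → len P ≤ suc k
  vertexRainbow-length {k = k} P (coloured , separated) = pred-bound (injective⇒≤ colour-injective)
    where
    colour : Fin (pred (len P)) → Fin k
    colour i = proj₁ (coloured (inner i) (inner-is-inner i))

    colour-injective : Injective _≡_ _≡_ colour
    colour-injective {i} {j} e = inner-injective
      (separated _ _ (inner-is-inner i) (inner-is-inner j)
        (trans (proj₂ (coloured _ (inner-is-inner i)))
               (trans (cong just e) (sym (proj₂ (coloured _ (inner-is-inner j)))))))

  totalRainbow-length : ∀ {u v k m} {cv : Fin N → Fin k} {ca : Fin N → Fin N → Fin k}
                        (P : Path D u v) → TotalRainbow cv ca P → k ≤ m + m → len P ≤ m
  totalRainbow-length {cv = cv} {ca} P total k≤m+m =
    half-bound (≤-trans (totalRainbowSeq-colours {σ = cv ∘ vtx P} {α = arcCol ca P} total) k≤m+m)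

  short-rainbow : ∀ {u v k} {c : Fin N → Fin N → Fin k} (P : Path D u v) →
                  len P ≤ 1 → Rainbow c P
  short-rainbow P short i j _ = fin≤1-unique short i j

  short-vertexRainbow : ∀ {u v k} {c : Fin N → Maybe (Fin k)} (P : Path D u v) →
                        len P ≤ 1 → VertexRainbow c P
  short-vertexRainbow P short = (λ i ii → ⊥-elim (no-inner short i ii)) ,
                                (λ i j ii _ _ → ⊥-elim (no-inner short i ii))

  short-totalRainbow : ∀ {u v k} {cv : Fin N → Fin k} {ca : Fin N → Fin N → Fin k}
                       (P : Path D u v) → len P ≤ 1 → TotalRainbow cv ca P
  short-totalRainbow {ca = ca} P short = short-rainbow {c = ca} P short ,
                               (λ i j ii _ _ → ⊥-elim (no-inner short i ii)) ,
                               (λ i j ij _ → no-inner short j ij)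

  coloured-vertexRainbow : ∀ {u v k} {c : Fin N → Maybe (Fin k)} →
    (∀ x → ∃ λ a → c x ≡ just a) → (P : Path D u v) → len P ≤ 2 → VertexRainbow c P
  coloured-vertexRainbow coloured P short = (λ i _ → coloured (vtx P i)) ,
                                            (λ i j ii ij _ → unique-inner short i j ii ij)

  vertexRainbow-extend : ∀ {u v k} {c c′ : Fin N → Maybe (Fin k)} →
    (∀ x a → c x ≡ just a → c′ x ≡ just a) → (P : Path D u v) →
    VertexRainbow c P → VertexRainbow c′ P
  vertexRainbow-extend {c = c} {c′} extends P (coloured , separated) =
    (λ i ii → map₂ (extends _ _) (coloured i ii)) ,
    λ i j ii ij e → separated i j ii ij (same-colour (coloured i ii) (coloured j ij) e)
    where
    same-colour : ∀ {x y} → ∃ (λ a → c x ≡ just a) → ∃ (λ b → c y ≡ just b) →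
                  c′ x ≡ c′ y → c x ≡ c y
    same-colour (a , ca) (b , cb) e =
      trans ca (trans (trans (sym (extends _ a ca)) (trans e (extends _ b cb))) (sym cb))

  totalRainbow-resp : ∀ {u v k} {cv cv′ : Fin N → Fin k} {ca ca′ : Fin N → Fin N → Fin k} →
    (∀ x → cv x ≡ cv′ x) → (∀ x y → ca x y ≡ ca′ x y) → (P : Path D u v) →
    TotalRainbow cv ca P → TotalRainbow cv′ ca′ P
  totalRainbow-resp ev ea P = totalRainbowSeq-resp (λ i → ev (vtx P i)) (λ i → ea _ _)

  src⇒rc : ∀ {k} → StrongRainbowConnecting D k → RainbowConnecting D k
  src⇒rc (c , conn) = c , λ u v u≢v → map₂ proj₂ (conn u v u≢v)

  srvc⇒rvc : ∀ {k} → StrongRainbowVertexConnecting D k → RainbowVertexConnecting D k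
  srvc⇒rvc (c , conn) = c , λ u v u≢v → map₂ proj₂ (conn u v u≢v)

  strc⇒trc : ∀ {k} → StrongTotalRainbowConnecting D k → TotalRainbowConnecting D k
  strc⇒trc (cv , ca , conn) = cv , ca , λ u v u≢v → map₂ proj₂ (conn u v u≢v)

  rc⇒src : ∀ {k} → k ≤ 2 → RainbowConnecting D k → StrongRainbowConnecting D k
  rc⇒src k≤2 (c , conn) =
    c , strengthen (Rainbow c) 1 (λ P rainbow → ≤-trans (rainbow-length {c = c} P rainbow) k≤2)
                                 (λ P → short-rainbow {c = c} P) conn

  rvc⇒srvc : ∀ {k} → k ≤ 2 → RainbowVertexConnecting D k → StrongRainbowVertexConnecting D k
  rvc⇒srvc {zero} _ (c , conn) =
    c , strengthen (VertexRainbow c) 0 (λ P → vertexRainbow-length {c = c} P)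
        (λ P short → short-vertexRainbow {c = c} P (≤-trans short z≤n)) conn
  rvc⇒srvc {suc k} k≤2 (c , conn) =
    filled , strengthen (VertexRainbow filled) 2
               (λ P vr → ≤-trans (vertexRainbow-length {c = filled} P vr) (s≤s k≤2))
               (coloured-vertexRainbow (λ x → fromMaybe zero (c x) , refl))
               (λ u v u≢v → map₂ (λ {P} → vertexRainbow-extend {c = c} filled-extends P)
                                 (conn u v u≢v))
    where
    filled : Fin N → Maybe (Fin (suc k))
    filled x = just (fromMaybe zero (c x))

    filled-extends : ∀ x a → c x ≡ just a → filled x ≡ just a
    filled-extends x a cx = cong (just ∘ fromMaybe zero) cx

  trc⇒strc : ∀ {k} → k ≤ 4 → TotalRainbowConnecting D k → StrongTotalRainbowConnecting D k
  trc⇒strc k≤4 (cv , ca , conn) =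
    cv , ca , strengthen (TotalRainbow cv ca) 1
                (λ P total → totalRainbow-length {m = 2} {cv = cv} {ca} P total k≤4)
                (λ P → short-totalRainbow {cv = cv} {ca} P) conn

  -- A rainbow 2-colouring of the arcs plus a third colour on all vertices is
  -- total-rainbow: rainbow paths have length ≤ 2, so at most one internal vertex.
  rc2⇒trc3 : RainbowConnecting D 2 → TotalRainbowConnecting D 3
  rc2⇒trc3 (c , conn) = (λ _ → fromℕ 2) , (λ x y → inject₁ (c x y)) , λ u v u≢v →
    let (P , rainbow) = conn u v u≢v in
    P , (λ i j e → rainbow i j (inject₁-injective e)) ,
        (λ i j ii ij _ → unique-inner (rainbow-length {c = c} P rainbow) i j ii ij) ,
        (λ i j _ e → fromℕ≢inject₁ (sym e))

  all-pairs? : {B : Fin N → Fin N → Set} → (∀ u v → Dec (B u v)) → Dec (∀ u v → u ≢ v → B u v)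
  all-pairs? B? = all? λ u → all? λ v → ¬? (u ≟ v) →-dec B? u v

  -- Total-rainbowness of a vertex sequence under (cv, ca); TotalRainbow cv ca P
  -- unfolds to RouteRainbow cv ca (len P) (vtx P).
  RouteRainbow : ∀ {k} → (Fin N → Fin k) → (Fin N → Fin N → Fin k) →
                 (l : ℕ) → (Fin (suc l) → Fin N) → Set
  RouteRainbow cv ca l f = TotalRainbowSeq l (cv ∘ f) (λ i → ca (f (inject₁ i)) (f (suc i)))

  routeRainbow-resp : ∀ {k} {cv : Fin N → Fin k} {ca l f g} → (∀ i → f i ≡ g i) →
                      RouteRainbow cv ca l f → RouteRainbow cv ca l g
  routeRainbow-resp {cv = cv} {ca} e =
    totalRainbowSeq-resp (λ i → cong cv (e i)) (λ i → cong₂ ca (e _) (e _))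

  open ColouringCode {N}

  trc? : ∀ k → Dec (TotalRainbowConnecting D k)
  trc? k = any-colouring?
    (λ ev ea conn u v u≢v → map₂ (λ {P} → totalRainbow-resp ev ea P) (conn u v u≢v))
    (λ cv ca → all-pairs? λ u v →
      any-path? u v (RouteRainbow cv ca) (λ l f → totalRainbowSeq? l _ _)
                    (λ l → routeRainbow-resp {cv = cv} {ca}))

  strc? : ∀ k → Dec (StrongTotalRainbowConnecting D k)
  strc? k = any-colouring?
    (λ ev ea conn u v u≢v → map₂ (λ {P} → map₂ (totalRainbow-resp ev ea P)) (conn u v u≢v))
    (λ cv ca → all-pairs? λ u v →
      any-path? u v (λ l f → (∀ (Q : Path D u v) → l ≤ len Q) × RouteRainbow cv ca l f)
                    (λ l f → shortest? u v l ×-dec totalRainbowSeq? l _ _)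
                    (λ l e → map₂ (routeRainbow-resp {cv = cv} {ca} e)))

  distinct-colouring : StronglyConnected D → StrongTotalRainbowConnecting D (N + N * N)
  distinct-colouring sc = (_↑ˡ N * N) , (λ x y → N ↑ʳ combine x y) , λ u v _ →
    let (G , G-geo) = geodesic (sc u v) in
    G , G-geo ,
    (λ i j e → inject₁-injective (distinct G (combine-injectiveˡ _ _ _ _ (↑ʳ-injective N _ _ e)))) ,
    (λ i j _ _ e → distinct G (↑ˡ-injective (N * N) _ _ e)) ,
    (λ i j _ → arc≢vertex)
    where
    -- arc colours and vertex colours lie in different summands of Fin (N + N * N)
    arc≢vertex : ∀ {x} {y : Fin (N * N)} → N ↑ʳ y ≢ x ↑ˡ N * N
    arc≢vertex {x} {y} e
      with trans (sym (splitAt-↑ʳ N (N * N) y))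
                 (trans (cong (splitAt N) e) (splitAt-↑ˡ N x (N * N)))
    ... | ()

module Theorem (D : Digraph) (nontrivial : NonTrivial D) (sc : StronglyConnected D) where
  open Paths D

  Within : ℕ → Set
  Within m = ∀ u v → u ≢ v → Σ (Path D u v) λ P → len P ≤ m

  complete⇒within1 : BiorientedComplete D → Within 1
  complete⇒within1 complete u v u≢v = arc-path (complete u v u≢v) u≢v , ≤-refl

  within1⇒complete : Within 1 → BiorientedComplete D
  within1⇒complete within u v u≢v =
    short⇒arc (proj₁ (within u v u≢v)) (proj₂ (within u v u≢v)) u≢v

  -- In a bioriented complete digraph the arcs are geodesics, so any property
  -- held by all paths of length ≤ 1 connects along geodesics.
  complete-geodesics : (X : ∀ {u v} → Path D u v → Set) →
    (∀ {u v} (P : Path D u v) → len P ≤ 1 → X P) → BiorientedComplete D →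
    ∀ u v → u ≢ v → Σ (Path D u v) λ P → IsGeodesic P × X P
  complete-geodesics X short complete u v u≢v =
    let P = arc-path (complete u v u≢v) u≢v in P , short⇒geodesic P u≢v ≤-refl , short P ≤-refl

  complete⇒src1 : BiorientedComplete D → StrongRainbowConnecting D 1
  complete⇒src1 complete =
    c , complete-geodesics (Rainbow c) (λ P → short-rainbow {c = c} P) complete
    where
    c : Fin N → Fin N → Fin 1
    c _ _ = zero

  complete⇒srvc0 : BiorientedComplete D → StrongRainbowVertexConnecting D 0
  complete⇒srvc0 complete =
    c , complete-geodesics (VertexRainbow c) (λ P → short-vertexRainbow {c = c} P) complete
    where
    c : Fin N → Maybe (Fin 0)
    c _ = nothing

  complete⇒strc1 : BiorientedComplete D → StrongTotalRainbowConnecting D 1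
  complete⇒strc1 complete =
    cv , ca , complete-geodesics (TotalRainbow cv ca)
                (λ P → short-totalRainbow {cv = cv} {ca} P) complete
    where
    cv : Fin N → Fin 1
    cv _ = zero
    ca : Fin N → Fin N → Fin 1
    ca _ _ = zero

  rc⇒within : ∀ {k} → RainbowConnecting D k → Within k
  rc⇒within (c , conn) u v u≢v = let (P , rainbow) = conn u v u≢v in
    P , rainbow-length {c = c} P rainbow

  rvc⇒within : ∀ {k} → RainbowVertexConnecting D k → Within (suc k)
  rvc⇒within (c , conn) u v u≢v = let (P , vr) = conn u v u≢v in
    P , vertexRainbow-length {c = c} P vr

  trc⇒within : ∀ {k m} → TotalRainbowConnecting D k → k ≤ m + m → Within m
  trc⇒within (cv , ca , conn) k≤m+m u v u≢v = let (P , total) = conn u v u≢v in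
    P , totalRainbow-length {cv = cv} {ca} P total k≤m+m

  x₀ x₁ : Fin N
  x₀ = fromℕ< {0} (≤-trans (s≤s z≤n) nontrivial)
  x₁ = fromℕ< {1} nontrivial

  x₀≢x₁ : x₀ ≢ x₁
  x₀≢x₁ e with trans (sym (toℕ-fromℕ< (≤-trans (s≤s z≤n) nontrivial)))
                     (trans (cong toℕ e) (toℕ-fromℕ< nontrivial))
  ... | ()

  no-rc0 : ¬ RainbowConnecting D 0
  no-rc0 (c , _) with c x₀ x₀
  ... | ()

  no-trc0 : ¬ TotalRainbowConnecting D 0
  no-trc0 (cv , _) with cv x₀
  ... | ()

  only-zero-below-one : ∀ {X : ℕ → Set} → ¬ X 0 → ∀ k → k < 1 → ¬ X k
  only-zero-below-one ¬x0 zero    _         = ¬x0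
  only-zero-below-one ¬x0 (suc _) (s≤s ())

  complete⇒diam1 : BiorientedComplete D → Diam D 1
  complete⇒diam1 complete =
    complete⇒within1 complete , x₀ , x₁ , x₀≢x₁ , P , short⇒geodesic P x₀≢x₁ ≤-refl , refl
    where
    P : Path D x₀ x₁
    P = arc-path (complete x₀ x₁ x₀≢x₁) x₀≢x₁

  diam1⇒complete : Diam D 1 → BiorientedComplete D
  diam1⇒complete (within , _) = within1⇒complete within

  missing-arc : ¬ BiorientedComplete D → ∃ λ u → ∃ λ v → u ≢ v × arc D u v ≢ true
  missing-arc incomplete with any? (λ u → any? λ v → ¬? (u ≟ v) ×-dec ¬? (arc D u v Bool.≟ true))
  ... | yes found = found
  ... | no none = ⊥-elim (incomplete λ u v u≢v →
          decidable-stable (arc D u v Bool.≟ true) λ no-arc → none (u , v , u≢v , no-arc))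

  within2⇒diam2 : Within 2 → ¬ BiorientedComplete D → Diam D 2
  within2⇒diam2 within incomplete with missing-arc incomplete
  ... | u , v , u≢v , no-arc with within u v u≢v
  ...   | P , P≤2 = within , u , v , u≢v , P , (λ Q → ≤-trans P≤2 (far Q)) , ≤-antisym P≤2 (far P)
    where
    far : (Q : Path D u v) → 2 ≤ len Q
    far Q = ≰⇒> λ Q≤1 → no-arc (short⇒arc Q Q≤1 u≢v)

  diam2⇒incomplete : Diam D 2 → ¬ BiorientedComplete D
  diam2⇒incomplete (_ , u , v , u≢v , P , P-geo , P≡2) complete =
    <-irrefl refl (subst (_≤ 1) P≡2 (P-geo (arc-path (complete u v u≢v) u≢v)))

  diam2-from : ∀ {X : ℕ → Set} {m b} → Within 2 → IsMinimum X m →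
               (BiorientedComplete D → X b) → b < m → Diam D 2
  diam2-from within minimal from-complete b<m =
    within2⇒diam2 within λ complete → below-minimum minimal (from-complete complete) b<m

  -- Part (a): each minimum equals its value on complete digraphs exactly when D
  -- is complete, since reaching it forces all distances ≤ 1.
  complete⇔minimum : ∀ {X : ℕ → Set} {b} → (BiorientedComplete D → X b) →
    (∀ k → k < b → ¬ X k) → (X b → Within 1) → BiorientedComplete D ⇔ IsMinimum X b
  complete⇔minimum from-complete none-below to-within =
    mk⇔ (λ complete → from-complete complete , none-below)
        (λ minimal → within1⇒complete (to-within (proj₁ minimal)))

  partA : (BiorientedComplete D ⇔ Diam D 1) × (BiorientedComplete D ⇔ Rc D 1) ×
          (BiorientedComplete D ⇔ Src D 1) × (BiorientedComplete D ⇔ Rvc D 0) ×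
          (BiorientedComplete D ⇔ Srvc D 0) × (BiorientedComplete D ⇔ Trc D 1) ×
          (BiorientedComplete D ⇔ Strc D 1)
  partA =
    mk⇔ complete⇒diam1 diam1⇒complete ,
    complete⇔minimum (src⇒rc ∘ complete⇒src1) (only-zero-below-one no-rc0) rc⇒within ,
    complete⇔minimum complete⇒src1 (only-zero-below-one (no-rc0 ∘ src⇒rc)) (rc⇒within ∘ src⇒rc) ,
    complete⇔minimum (srvc⇒rvc ∘ complete⇒srvc0) (λ _ ()) rvc⇒within ,
    complete⇔minimum complete⇒srvc0 (λ _ ()) (rvc⇒within ∘ srvc⇒rvc) ,
    complete⇔minimum (strc⇒trc ∘ complete⇒strc1) (only-zero-below-one no-trc0)
                     (λ trc → trc⇒within trc (s≤s z≤n)) ,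
    complete⇔minimum complete⇒strc1 (only-zero-below-one (no-trc0 ∘ strc⇒trc))
                     (λ strc → trc⇒within (strc⇒trc strc) (s≤s z≤n))

  -- Part (b): both minima exist (by decidability and the distinct colouring);
  -- strc ≥ trc as geodesic connection is connection; trc ≥ 3 as trc ≤ 2 forces
  -- distances ≤ 1; and trc ≥ 3 fails for complete D, where trc = 1.
  partB : Σ ℕ (λ s → Σ ℕ (λ t → Strc D s × Trc D t × t ≤ s × 3 ≤ t)) ⇔ (¬ BiorientedComplete D)
  partB = mk⇔ large⇒incomplete incomplete⇒large
    where
    large⇒incomplete : Σ ℕ (λ s → Σ ℕ (λ t → Strc D s × Trc D t × t ≤ s × 3 ≤ t)) →
                       ¬ BiorientedComplete D
    large⇒incomplete (_ , _ , _ , trc-t , _ , 3≤t) complete =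
      below-minimum trc-t (strc⇒trc (complete⇒strc1 complete)) (≤-trans (s≤s (s≤s z≤n)) 3≤t)

    incomplete⇒large : ¬ BiorientedComplete D →
                       Σ ℕ (λ s → Σ ℕ (λ t → Strc D s × Trc D t × t ≤ s × 3 ≤ t))
    incomplete⇒large incomplete =
      from-minima (minimum strc? (distinct-colouring sc))
                  (minimum trc? (strc⇒trc (distinct-colouring sc)))
      where
      from-minima : Σ ℕ (Strc D) → Σ ℕ (Trc D) →
                    Σ ℕ (λ s → Σ ℕ (λ t → Strc D s × Trc D t × t ≤ s × 3 ≤ t))
      from-minima (s , strc-s) (t , trc-t) =
        s , t , strc-s , trc-t ,
        ≮⇒≥ (λ s<t → below-minimum trc-t (strc⇒trc (proj₁ strc-s)) s<t) ,
        ≮⇒≥ (λ t<3 → incomplete (within1⇒complete (trc⇒within (proj₁ trc-t) (≤-pred t<3))))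

  -- Part (c)(i)-(v): below the thresholds 2 (arc, vertex) and 4 (total) the
  -- weak and strong colourings coincide, hence so do their minima.
  rc2⇔src2 : Rc D 2 ⇔ Src D 2
  rc2⇔src2 = minimum-agree 2 rc⇒src (λ _ → src⇒rc) ≤-refl

  rvc1⇔srvc1 : Rvc D 1 ⇔ Srvc D 1
  rvc1⇔srvc1 = minimum-agree 2 rvc⇒srvc (λ _ → srvc⇒rvc) (s≤s z≤n)

  rvc2⇔srvc2 : Rvc D 2 ⇔ Srvc D 2
  rvc2⇔srvc2 = minimum-agree 2 rvc⇒srvc (λ _ → srvc⇒rvc) ≤-refl

  trc3⇔strc3 : Trc D 3 ⇔ Strc D 3
  trc3⇔strc3 = minimum-agree 4 trc⇒strc (λ _ → strc⇒trc) (s≤s (s≤s (s≤s z≤n)))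

  trc4⇔strc4 : Trc D 4 ⇔ Strc D 4
  trc4⇔strc4 = minimum-agree 4 trc⇒strc (λ _ → strc⇒trc) ≤-refl

  within2⇒rvc1 : Within 2 → RainbowVertexConnecting D 1
  within2⇒rvc1 within = c , λ u v u≢v →
    map₂ (λ {P} → coloured-vertexRainbow {c = c} (λ _ → zero , refl) P) (within u v u≢v)
    where
    c : Fin N → Maybe (Fin 1)
    c _ = just zero

  srvc1⇔diam2 : Srvc D 1 ⇔ Diam D 2
  srvc1⇔diam2 = mk⇔
    (λ srvc1 → diam2-from (rvc⇒within (srvc⇒rvc (proj₁ srvc1))) srvc1 complete⇒srvc0 (s≤s z≤n))
    (λ diam2 → rvc⇒srvc (s≤s z≤n) (within2⇒rvc1 (proj₁ diam2)) ,
               only-zero-below-one λ srvc0 →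
                 diam2⇒incomplete diam2 (within1⇒complete (rvc⇒within (srvc⇒rvc srvc0))))

  -- rc = 2 gives trc = 3: rc2⇒trc3 gives 3 colours, and ≤ 2 would force completeness.
  rc2⇒trc3-minimum : Rc D 2 → Trc D 3
  rc2⇒trc3-minimum rc2 = rc2⇒trc3 (proj₁ rc2) , λ k k<3 trc →
    below-minimum rc2 (src⇒rc (complete⇒src1 (within1⇒complete (trc⇒within trc (≤-pred k<3)))))
                  (s≤s (s≤s z≤n))

  rc2⇒trc3×strc3 : Rc D 2 ⊎ Src D 2 → Trc D 3 × Strc D 3
  rc2⇒trc3×strc3 rc-or-src = trc3 , Equivalence.to trc3⇔strc3 trc3
    where
    trc3 : Trc D 3
    trc3 = rc2⇒trc3-minimum ([ (λ rc2 → rc2) , Equivalence.from rc2⇔src2 ]′ rc-or-src)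

  -- Each of rc = 2, trc = 3, trc = 4 (and their strong versions) forces
  -- distances ≤ 2 and excludes completeness, i.e. gives diameter 2.
  diam2-from-small : Rc D 2 ⊎ Src D 2 ⊎ Trc D 3 ⊎ Strc D 3 ⊎ Trc D 4 ⊎ Strc D 4 → Diam D 2
  diam2-from-small (inj₁ rc2) =
    diam2-from (rc⇒within (proj₁ rc2)) rc2 (src⇒rc ∘ complete⇒src1) (s≤s (s≤s z≤n))
  diam2-from-small (inj₂ (inj₁ src2)) = diam2-from-small (inj₁ (Equivalence.from rc2⇔src2 src2))
  diam2-from-small (inj₂ (inj₂ (inj₁ trc3))) =
    diam2-from (trc⇒within (proj₁ trc3) (s≤s (s≤s (s≤s z≤n)))) trc3
               (strc⇒trc ∘ complete⇒strc1) (s≤s (s≤s z≤n))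
  diam2-from-small (inj₂ (inj₂ (inj₂ (inj₁ strc3)))) =
    diam2-from-small (inj₂ (inj₂ (inj₁ (Equivalence.from trc3⇔strc3 strc3))))
  diam2-from-small (inj₂ (inj₂ (inj₂ (inj₂ (inj₁ trc4))))) =
    diam2-from (trc⇒within (proj₁ trc4) ≤-refl) trc4 (strc⇒trc ∘ complete⇒strc1) (s≤s (s≤s z≤n))
  diam2-from-small (inj₂ (inj₂ (inj₂ (inj₂ (inj₂ strc4))))) =
    diam2-from-small (inj₂ (inj₂ (inj₂ (inj₂ (inj₁ (Equivalence.from trc4⇔strc4 strc4))))))

  diam2⇒rvc1×srvc1 : Diam D 2 → Rvc D 1 × Srvc D 1 × Diam D 2
  diam2⇒rvc1×srvc1 diam2 = Equivalence.from rvc1⇔srvc1 srvc1 , srvc1 , diam2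
    where
    srvc1 : Srvc D 1
    srvc1 = Equivalence.from srvc1⇔diam2 diam2

theorem2 : (D : Digraph) → NonTrivial D → StronglyConnected D →
    ((BiorientedComplete D ⇔ Diam D 1) ×
     (BiorientedComplete D ⇔ Rc D 1) ×
     (BiorientedComplete D ⇔ Src D 1) ×
     (BiorientedComplete D ⇔ Rvc D 0) ×
     (BiorientedComplete D ⇔ Srvc D 0) ×
     (BiorientedComplete D ⇔ Trc D 1) ×
     (BiorientedComplete D ⇔ Strc D 1)) ×
    ((Σ ℕ (λ s → Σ ℕ (λ t → Strc D s × Trc D t × t ≤ s × 3 ≤ t))) ⇔ (¬ BiorientedComplete D)) ×
    ((Rc D 2 ⇔ Src D 2) ×
     (Rvc D 1 ⇔ Srvc D 1) × (Srvc D 1 ⇔ Diam D 2) ×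
     (Rvc D 2 ⇔ Srvc D 2) ×
     (Trc D 3 ⇔ Strc D 3) ×
     (Trc D 4 ⇔ Strc D 4) ×
     ((Rc D 2 ⊎ Src D 2) → Trc D 3 × Strc D 3) ×
     ((Rc D 2 ⊎ Src D 2 ⊎ Trc D 3 ⊎ Strc D 3 ⊎ Trc D 4 ⊎ Strc D 4) →
        Rvc D 1 × Srvc D 1 × Diam D 2))
theorem2 D nontrivial sc =
  partA ,
  partB ,
  (rc2⇔src2 , rvc1⇔srvc1 , srvc1⇔diam2 , rvc2⇔srvc2 , trc3⇔strc3 , trc4⇔strc4 ,
   rc2⇒trc3×strc3 , diam2⇒rvc1×srvc1 ∘ diam2-from-small)
  where
  open Theorem D nontrivial sc
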